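{- Let $m,n$ be positive integers and $t$ a nonnegative integer. Let $P$ be an induced path of a graph $G$, and let $x\in V(G)\setminus V(P)$ be such that $G\setminus V(P)\setminus x$ has $t$ components and $x$ has at least $(m+2)n^t$ neighbors in $P$. Then either $G$ has a $K_{2,n}$-minor, or $P$ has a subpath $P^*$ such that $x$ has $m$ neighbors in $P^*$ and no vertex outside $P$ other than $x$ has a neighbor in $P^*$.
   Context: Graphs are finite and simple. -}

module Defs where

open import Data.Nat using (ℕ; zero; suc; _+_; _*_; _^_; _≤_; _≤ᵇ_; _<ᵇ_)
open import Data.Fin using (Fin; toℕ; inject₁) renaming (zero to fzero; suc to fsuc)
open import Data.Bool using (Bool; true; false; _∧_; _xor_; if_then_else_)
open import Data.Product using (Σ; ∃; ∃-syntax; _×_; _,_)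
open import Data.Sum using (_⊎_)
open import Relation.Binary.PropositionalEquality using (_≡_; _≢_; refl)
open import Relation.Nullary using (¬_)
open import Function.Bundles using (_⇔_)

record Graph (N : ℕ) : Set where
  field
    adj    : Fin N → Fin N → Bool
    sym    : ∀ u v → adj u v ≡ adj v u
    irrefl : ∀ v → adj v v ≡ false

open Graph public

Edge : ∀ {N} → Graph N → Fin N → Fin N → Set
Edge G u v = adj G u v ≡ true

data Reach {N : ℕ} (G : Graph N) (S : Fin N → Set) (u : Fin N) : Fin N → Set where
  here : S u → Reach G S u u
  step : ∀ {w v} → Reach G S u w → Edge G w v → S v → Reach G S u v

-- The induced subgraph G[S] has exactly t connected components:
-- there is a labelling of the vertices of S by Fin t, onto Fin t, such that
-- two vertices of S get the same label iff they are connected in G[S].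
HasComponents : ∀ {N} → Graph N → (Fin N → Set) → ℕ → Set
HasComponents {N} G S t =
  Σ ((v : Fin N) → S v → Fin t) λ f →
    (∀ (c : Fin t) → ∃[ v ] Σ (S v) λ s → f v s ≡ c)
    × (∀ u v (su : S u) (sv : S v) → (f u su ≡ f v sv) ⇔ Reach G S u v)

-- Minors: G has an H-minor iff there are nonempty, pairwise disjoint,
-- connected branch sets B_h (h ∈ V(H)) with an edge of G between B_h and
-- B_h' whenever hh' ∈ E(H).

HasMinor : ∀ {N h} → Graph N → Graph h → Set₁
HasMinor {N} {h} G H =
  Σ (Fin h → Fin N → Set) λ B →
    (∀ i → ∃[ v ] B i v)
    × (∀ i j v → B i v → B j v → i ≡ j)
    × (∀ i u v → B i u → B i v → Reach G (B i) u v)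
    × (∀ i j → Edge H i j → ∃[ u ] ∃[ v ] (B i u × B j v × Edge G u v))

-- Complete bipartite graph K_{2,n}: vertices 0,1 form one side,
-- vertices 2,…,n+1 the other side.
private
  side : ∀ {n} → Fin n → Bool
  side i = toℕ i <ᵇ 2

  xor-self : ∀ b → (b xor b) ≡ false
  xor-self true  = refl
  xor-self false = refl

  xor-comm : ∀ a b → (a xor b) ≡ (b xor a)
  xor-comm true  true  = refl
  xor-comm true  false = refl
  xor-comm false true  = refl
  xor-comm false false = refl

K2 : (n : ℕ) → Graph (2 + n)
K2 n = record
  { adj    = λ u v → side u xor side v
  ; sym    = λ u v → xor-comm (side u) (side v)
  ; irrefl = λ v → xor-self (side v)
  }

count : ∀ k → (Fin k → Bool) → ℕ
count zero    p = 0
count (suc k) p = (if p fzero then 1 else 0) + count k (λ i → p (fsuc i))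

-- A path in G with vertices vert 0, …, vert len (len + 1 vertices).
record Path {N : ℕ} (G : Graph N) : Set where
  field
    len   : ℕ
    vert  : Fin (suc len) → Fin N
    inj   : ∀ i j → vert i ≡ vert j → i ≡ j
    edges : ∀ (i : Fin len) → Edge G (vert (inject₁ i)) (vert (fsuc i))

open Path public

Induced : ∀ {N} {G : Graph N} → Path G → Set
Induced {G = G} P =
  ∀ i j → Edge G (vert P i) (vert P j) →
    toℕ i ≡ suc (toℕ j) ⊎ toℕ j ≡ suc (toℕ i)

_∈P_ : ∀ {N} {G : Graph N} → Fin N → Path G → Set
v ∈P P = ∃[ i ] vert P i ≡ v

nbrsInPath : ∀ {N} {G : Graph N} → Fin N → Path G → ℕ
nbrsInPath {G = G} x P = count (suc (len P)) (λ i → adj G x (vert P i))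

-- The subpath P[a..b] consists of vert a, …, vert b (a ≤ b ≤ len).
-- number of neighbours of x in the subpath P[a..b]
nbrsInSubpath : ∀ {N} {G : Graph N} → Fin N → (P : Path G) → ℕ → ℕ → ℕ
nbrsInSubpath {G = G} x P a b =
  count (suc (len P)) (λ i → (a ≤ᵇ toℕ i) ∧ (toℕ i ≤ᵇ b) ∧ adj G x (vert P i))

Outside : ∀ {N} {G : Graph N} → Path G → Fin N → Fin N → Set
Outside P x v = ¬ (v ∈P P) × v ≢ x

GoodSubpath : ∀ {N} (G : Graph N) → Path G → Fin N → ℕ → Set
GoodSubpath G P x m =
  ∃[ a ] ∃[ b ] (a ≤ b × b ≤ len P
    × nbrsInSubpath x P a b ≡ m
    × (∀ v → Outside P x v → ∀ i → a ≤ toℕ i → toℕ i ≤ b →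
         ¬ Edge G v (vert P i)))

module Submission where

-- Write nb a b for the number of neighbours of x among the positions a..b of
-- P.  As b grows by one, nb a b grows by at most one, so every value between
-- 1 and nb a b is attained by some prefix (a discrete intermediate value
-- theorem).  The heart of the proof is a claim proved by induction on a list
-- L of components of G ∖ V(P) ∖ x: if every outside vertex adjacent to
-- P[a..b] lies in a component of L and nb a b ≥ m·n^|L|, the conclusion
-- holds.  For L = [] the prefix of P[a..b] with exactly m neighbours of x is
-- the required subpath.  For L = c ∷ L' cut P[a..b] greedily into n
-- consecutive blocks with m·n^|L'| neighbours of x each.  If c touches every
-- block, then {x}, c and the n blocks are the branch sets of a K_{2,n}-minor;
-- otherwise the first untouched block satisfies the claim's hypothesis for L'.
-- The theorem is the instance L = all t components, [a,b] = all of P.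

open import Defs
open import Data.Nat using (ℕ; zero; suc; _+_; _*_; _^_; _≤_; _<_; _≤ᵇ_; _≤?_; z≤n; s≤s)
open import Data.Nat.Properties
  using (≤-refl; ≤-trans; ≤-antisym; ≤-reflexive; <⇒≤; ≰⇒>; n≤1+n; m≤n⇒m≤1+n; 1+n≰n;
         n≤0⇒n≡0; m≤m+n; +-comm; +-identityʳ; +-monoʳ-≤; +-cancelˡ-≤; *-identityʳ;
         *-mono-≤; *-monoˡ-≤; suc-injective; ≤ᵇ⇒≤; ≤⇒≤ᵇ; module ≤-Reasoning;
         +-commutativeSemigroup; *-commutativeSemigroup)
open import Algebra.Properties.CommutativeSemigroup +-commutativeSemigroup using (interchange)
open import Algebra.Properties.CommutativeSemigroup *-commutativeSemigroup using (x∙yz≈y∙xz)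
open import Data.Fin using (Fin; toℕ; inject₁; _≟_) renaming (zero to fzero; suc to fsuc)
open import Data.Fin.Properties using (toℕ-injective; toℕ-inject₁; toℕ≤pred[n]; any?; 0≢1+n)
  renaming (suc-injective to fsuc-injective)
open import Data.Bool using (Bool; true; false; _∧_; if_then_else_)
open import Data.Bool.Properties using (T-≡; T-∧; ¬-not) renaming (_≟_ to _≟ᵇ_)
open import Data.Product using (Σ; ∃-syntax; _×_; _,_; proj₁)
open import Data.Sum using (_⊎_; inj₁; inj₂) renaming (map to ⊎-map)
open import Data.Empty using (⊥-elim)
open import Data.List using (List; []; _∷_; length; allFin)
open import Data.List.Properties using (length-tabulate)
open import Data.List.Membership.Propositional using (_∈_)
open import Data.List.Membership.Propositional.Properties using (∈-allFin)
open import Data.List.Relation.Unary.Any using (here; there)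
open import Function using (_∘_; id)
open import Function.Bundles using (_⇔_; Equivalence)
open import Relation.Nullary using (¬_; Dec; yes; no; contradiction)
open import Relation.Nullary.Decidable using (¬?; _×-dec_; map′)
open import Relation.Binary.PropositionalEquality
  using (_≡_; refl; cong; trans; subst) renaming (sym to ≡-sym)

iverson : Bool → ℕ
iverson b = if b then 1 else 0

count-ext : ∀ k {p q : Fin k → Bool} → (∀ i → p i ≡ q i) → count k p ≡ count k q
count-ext zero    p≡q = refl
count-ext (suc k) p≡q rewrite p≡q fzero = cong (_ +_) (count-ext k (p≡q ∘ fsuc))

count-sum : ∀ k (p q r : Fin k → Bool) →
  (∀ i → iverson (r i) ≡ iverson (p i) + iverson (q i)) →
  count k r ≡ count k p + count k q
count-sum zero    p q r r≡p+q = refl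
count-sum (suc k) p q r r≡p+q
  rewrite r≡p+q fzero | count-sum k (p ∘ fsuc) (q ∘ fsuc) (r ∘ fsuc) (r≡p+q ∘ fsuc) =
  interchange (iverson (p fzero)) (iverson (q fzero)) _ _

count-none : ∀ k {r : Fin k → Bool} → (∀ i → r i ≡ false) → count k r ≡ 0
count-none zero    r≡false = refl
count-none (suc k) r≡false rewrite r≡false fzero = count-none k (r≡false ∘ fsuc)

count-atMostOne : ∀ k (r : Fin k → Bool) →
  (∀ i j → r i ≡ true → r j ≡ true → i ≡ j) → count k r ≤ 1
count-atMostOne zero    r unique = z≤n
count-atMostOne (suc k) r unique with r fzero in r0
... | true  = ≤-reflexive (cong suc (count-none k rest))
  where
  rest : ∀ i → r (fsuc i) ≡ false
  rest i = ¬-not (λ ri → 0≢1+n (unique fzero (fsuc i) r0 ri))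
... | false = count-atMostOne k (r ∘ fsuc)
                (λ i j ri rj → fsuc-injective (unique (fsuc i) (fsuc j) ri rj))

count-witness : ∀ k (r : Fin k → Bool) → 1 ≤ count k r → ∃[ i ] r i ≡ true
count-witness (suc k) r pos with r fzero in r0
... | true  = fzero , r0
... | false = let (i , ri) = count-witness k (r ∘ fsuc) pos in fsuc i , ri

discrete-ivt : (g : ℕ → ℕ) → g 0 ≤ 1 → (∀ c → g (suc c) ≤ suc (g c)) →
  ∀ {B} → 1 ≤ B → ∀ c → B ≤ g c → ∃[ c' ] c' ≤ c × g c' ≡ B
discrete-ivt g g0≤1 slow B≥1 zero B≤g0 = 0 , z≤n , ≤-antisym (≤-trans g0≤1 B≥1) B≤g0
discrete-ivt g g0≤1 slow {B} B≥1 (suc c) B≤g with B ≤? g c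
... | yes B≤gc = let (c' , c'≤c , gc'≡B) = discrete-ivt g g0≤1 slow B≥1 c B≤gc
                 in c' , m≤n⇒m≤1+n c'≤c , gc'≡B
... | no  B≰gc = suc c , ≤-refl , ≤-antisym (≤-trans (slow c) (≰⇒> B≰gc)) B≤g

≤ᵇ-true : ∀ {m n} → m ≤ n → (m ≤ᵇ n) ≡ true
≤ᵇ-true m≤n = Equivalence.to T-≡ (≤⇒≤ᵇ m≤n)

≤ᵇ-false : ∀ {m n} → ¬ m ≤ n → (m ≤ᵇ n) ≡ false
≤ᵇ-false {m} {n} m≰n = ¬-not (λ eq → m≰n (≤ᵇ⇒≤ m n (Equivalence.from T-≡ eq)))

module Reachability {N : ℕ} (G : Graph N) where

  edge-sym : ∀ {u v} → Edge G u v → Edge G v u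
  edge-sym {u} {v} e = trans (Graph.sym G v u) e

  reach-cons : ∀ {S : Fin N → Set} {u v w} →
    Edge G v w → S v → Reach G S w u → Reach G S v u
  reach-cons e sv (here sw)       = step (here sv) e sw
  reach-cons e sv (step r e' su)  = step (reach-cons e sv r) e' su

  reach-sym : ∀ {S : Fin N → Set} {u v} → Reach G S u v → Reach G S v u
  reach-sym (here su)     = here su
  reach-sym (step r e sv) = reach-cons (edge-sym e) sv (reach-sym r)

  reach-target : ∀ {S : Fin N → Set} {u v} → Reach G S u v → S v
  reach-target (here s)     = s
  reach-target (step _ _ s) = s

  reach-restrict : ∀ {S T : Fin N → Set} {u v} → Reach G S u v →
    (∀ w → Reach G S u w → T w) → Reach G T u v
  reach-restrict r@(here _)      inT = here (inT _ r)
  reach-restrict r@(step r' e _) inT = step (reach-restrict r' inT) e (inT _ r)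

  segment-reach : (P : Path G) (T : Fin N → Set) {i j : Fin (suc (len P))} →
    toℕ i ≤ toℕ j → (∀ l → toℕ i ≤ toℕ l → toℕ l ≤ toℕ j → T (vert P l)) →
    Reach G T (vert P i) (vert P j)
  segment-reach P T {i} {j} = walk (toℕ j) j refl
    where
    endpoint : ∀ {j} → toℕ i ≡ toℕ j → T (vert P i) → Reach G T (vert P i) (vert P j)
    endpoint i≡j ti with toℕ-injective i≡j
    ... | refl = here ti

    walk : ∀ k (j : Fin (suc (len P))) → toℕ j ≡ k → toℕ i ≤ k →
      (∀ l → toℕ i ≤ toℕ l → toℕ l ≤ k → T (vert P l)) → Reach G T (vert P i) (vert P j)
    walk zero    j       j≡0 i≤0 inT =
      endpoint (trans (n≤0⇒n≡0 i≤0) (≡-sym j≡0)) (inT i ≤-refl i≤0)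
    walk (suc k) fzero   ()  _   _
    walk (suc k) (fsuc j) j≡k i≤k inT with toℕ i ≤? k
    ... | yes i≤k' =
      step (walk k (inject₁ j) (trans (toℕ-inject₁ j) (suc-injective j≡k)) i≤k'
                 (λ l i≤l l≤k → inT l i≤l (m≤n⇒m≤1+n l≤k)))
           (edges P j)
           (inT (fsuc j) (≤-trans i≤k (≤-reflexive (≡-sym j≡k))) (≤-reflexive j≡k))
    ... | no  i≰k' = endpoint (trans (≤-antisym i≤k (≰⇒> i≰k')) (≡-sym j≡k)) (inT i ≤-refl i≤k)

module NeighbourCount {N : ℕ} {G : Graph N} (x : Fin N) (P : Path G) where

  inSub : ℕ → ℕ → Fin (suc (len P)) → Bool
  inSub a b i = (a ≤ᵇ toℕ i) ∧ (toℕ i ≤ᵇ b) ∧ adj G x (vert P i)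

  nb : ℕ → ℕ → ℕ
  nb = nbrsInSubpath x P

  inSub-sound : ∀ a b i → inSub a b i ≡ true →
    a ≤ toℕ i × toℕ i ≤ b × Edge G x (vert P i)
  inSub-sound a b i eq =
    let (a≤i , rest) = Equivalence.to T-∧ (Equivalence.from T-≡ eq)
        (i≤b , xi)   = Equivalence.to T-∧ rest
    in ≤ᵇ⇒≤ a (toℕ i) a≤i , ≤ᵇ⇒≤ (toℕ i) b i≤b , Equivalence.to T-≡ xi

  nb-witness : ∀ {a b} → 1 ≤ nb a b → ∃[ i ] a ≤ toℕ i × toℕ i ≤ b × Edge G x (vert P i)
  nb-witness {a} {b} pos = let (i , eq) = count-witness _ (inSub a b) pos
                           in i , inSub-sound a b i eq

  nb-split : ∀ {a b c} → a ≤ suc c → c ≤ b → nb a b ≡ nb a c + nb (suc c) b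
  nb-split {a} {b} {c} a≤1+c c≤b =
    count-sum _ (inSub a c) (inSub (suc c) b) (inSub a b) pointwise
    where
    pointwise : ∀ i → iverson (inSub a b i) ≡ iverson (inSub a c i) + iverson (inSub (suc c) b i)
    pointwise i with toℕ i ≤? c
    ... | yes i≤c rewrite ≤ᵇ-true (≤-trans i≤c c≤b) | ≤ᵇ-true i≤c
                        | ≤ᵇ-false {suc c} {toℕ i} (λ c<i → 1+n≰n (≤-trans c<i i≤c)) =
      ≡-sym (+-identityʳ _)
    ... | no  i≰c rewrite ≤ᵇ-true {a} {toℕ i} (≤-trans a≤1+c (≰⇒> i≰c)) | ≤ᵇ-false i≰c
                        | ≤ᵇ-true {suc c} {toℕ i} (≰⇒> i≰c) = refl

  nb-empty : ∀ {a b} → b < a → nb a b ≡ 0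
  nb-empty {a} {b} b<a = count-none _ outside
    where
    outside : ∀ i → inSub a b i ≡ false
    outside i with a ≤? toℕ i
    ... | yes a≤i rewrite ≤ᵇ-true a≤i
                        | ≤ᵇ-false {toℕ i} {b} (λ i≤b → 1+n≰n (≤-trans b<a (≤-trans a≤i i≤b))) = refl
    ... | no  a≰i rewrite ≤ᵇ-false a≰i = refl

  nb-singleton : ∀ d → nb d d ≤ 1
  nb-singleton d = count-atMostOne _ (inSub d d) same
    where
    same : ∀ i j → inSub d d i ≡ true → inSub d d j ≡ true → i ≡ j
    same i j di dj =
      let (d≤i , i≤d , _) = inSub-sound d d i di
          (d≤j , j≤d , _) = inSub-sound d d j dj
      in toℕ-injective (trans (≤-antisym i≤d d≤i) (≤-antisym d≤j j≤d))

  nb-step : ∀ a c → nb a (suc c) ≤ suc (nb a c)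
  nb-step a c with a ≤? suc c
  ... | yes a≤1+c = begin
    nb a (suc c)                 ≡⟨ nb-split a≤1+c (n≤1+n c) ⟩
    nb a c + nb (suc c) (suc c)  ≤⟨ +-monoʳ-≤ (nb a c) (nb-singleton (suc c)) ⟩
    nb a c + 1                   ≡⟨ +-comm (nb a c) 1 ⟩
    suc (nb a c)                 ∎
    where open ≤-Reasoning
  ... | no  a≰1+c rewrite nb-empty (≰⇒> a≰1+c) = z≤n

  nb-start : ∀ a → nb a 0 ≤ 1
  nb-start zero    = nb-singleton 0
  nb-start (suc a) rewrite nb-empty {suc a} {0} (s≤s z≤n) = z≤n

  nb-nonempty : ∀ {a b} → 1 ≤ nb a b → a ≤ b
  nb-nonempty {a} {b} pos with a ≤? b
  ... | yes a≤b = a≤b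
  ... | no  a≰b = contradiction (subst (1 ≤_) (nb-empty (≰⇒> a≰b)) pos) λ ()

  nb-prefix : ∀ {a b B} → 1 ≤ B → B ≤ nb a b → ∃[ c ] c ≤ b × nb a c ≡ B
  nb-prefix {a} {b} B≥1 = discrete-ivt (nb a) (nb-start a) (nb-step a) B≥1 b

  nb-whole : nb 0 (len P) ≡ nbrsInPath x P
  nb-whole = count-ext _ (λ i → cong (_∧ adj G x (vert P i)) (≤ᵇ-true (toℕ≤pred[n] i)))

module Components {N : ℕ} (G : Graph N) (P : Path G) (x : Fin N) (x∉P : ¬ (x ∈P P))
  {t : ℕ} (comp : (v : Fin N) → Outside P x v → Fin t)
  (comp-onto : ∀ c → ∃[ v ] Σ (Outside P x v) λ s → comp v s ≡ c)
  (comp-reach : ∀ u v (su : Outside P x u) (sv : Outside P x v) →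
                (comp u su ≡ comp v sv) ⇔ Reach G (Outside P x) u v) where

  open Reachability G
  open NeighbourCount x P

  Out : Fin N → Set
  Out = Outside P x

  Component : Fin t → Fin N → Set
  Component c v = Σ (Out v) λ s → comp v s ≡ c

  Touches : Fin t → ℕ → ℕ → Set
  Touches c lo hi = ∃[ v ] (Component c v × ∃[ i ] lo ≤ toℕ i × toℕ i ≤ hi × Edge G v (vert P i))

  comp-irrelevant : ∀ {v} (s s' : Out v) → comp v s ≡ comp v s'
  comp-irrelevant {v} s s' = Equivalence.from (comp-reach v v s s') (here s)

  component-connected : ∀ {c u v} → Component c u → Component c v → Reach G (Component c) u v
  component-connected {c} {u} {v} (su , su≡c) (sv , sv≡c) =
    reach-restrict (Equivalence.to (comp-reach u v su sv) (trans su≡c (≡-sym sv≡c))) stays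
    where
    stays : ∀ w → Reach G Out u w → Component c w
    stays w r = reach-target r ,
      trans (≡-sym (Equivalence.from (comp-reach u w su (reach-target r)) r)) su≡c

  outside? : ∀ v → Dec (Out v)
  outside? v = ¬? (any? λ i → vert P i ≟ v) ×-dec ¬? (v ≟ x)

  component? : ∀ c v → Dec (Component c v)
  component? c v with outside? v
  ... | no  ¬out = no (¬out ∘ proj₁)
  ... | yes out  = map′ (out ,_) (λ (s , s≡c) → trans (comp-irrelevant out s) s≡c) (comp v out ≟ c)

  touches? : ∀ c lo hi → Dec (Touches c lo hi)
  touches? c lo hi = any? λ v → component? c v ×-dec adjacent? v
    where
    adjacent? : ∀ v → Dec (∃[ i ] lo ≤ toℕ i × toℕ i ≤ hi × Edge G v (vert P i))
    adjacent? v = any? λ i → (lo ≤? toℕ i) ×-dec (toℕ i ≤? hi) ×-dec (adj G v (vert P i) ≟ᵇ true)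

  record TouchedBlocks (c : Fin t) (q a : ℕ) : Set where
    field
      lo hi    : Fin q → ℕ
      after    : ∀ j → a ≤ lo j
      has-nbr  : ∀ j → 1 ≤ nb (lo j) (hi j)
      touched  : ∀ j → Touches c (lo j) (hi j)
      disjoint : ∀ j j' k → lo j ≤ k → k ≤ hi j → lo j' ≤ k → k ≤ hi j' → j ≡ j'

  no-blocks : ∀ {c a} → TouchedBlocks c 0 a
  no-blocks = record
    { lo = λ () ; hi = λ () ; after = λ () ; has-nbr = λ () ; touched = λ () ; disjoint = λ () }

  cons-block : ∀ {c q a a'} → 1 ≤ nb a a' → Touches c a a' →
    TouchedBlocks c q (suc a') → TouchedBlocks c (suc q) a
  cons-block {c} {q} {a} {a'} pos tc bs = record
    { lo       = lo′
    ; hi       = hi′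
    ; after    = λ { fzero → ≤-refl ; (fsuc j) → ≤-trans a≤1+a' (after j) }
    ; has-nbr  = λ { fzero → pos ; (fsuc j) → has-nbr j }
    ; touched  = λ { fzero → tc ; (fsuc j) → touched j }
    ; disjoint = disjoint′
    }
    where
    open TouchedBlocks bs
    a≤1+a' : a ≤ suc a'
    a≤1+a' = m≤n⇒m≤1+n (nb-nonempty pos)

    lo′ hi′ : Fin (suc q) → ℕ
    lo′ fzero    = a
    lo′ (fsuc j) = lo j
    hi′ fzero    = a'
    hi′ (fsuc j) = hi j

    -- a position in both the new block and block j would precede lo j
    disjoint′ : ∀ j j' k → lo′ j ≤ k → k ≤ hi′ j → lo′ j' ≤ k → k ≤ hi′ j' → j ≡ j'
    disjoint′ fzero    fzero     k _    _    _    _    = refl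
    disjoint′ fzero    (fsuc j') k _    k≤a' lo≤k _    =
      ⊥-elim (1+n≰n (≤-trans (after j') (≤-trans lo≤k k≤a')))
    disjoint′ (fsuc j) fzero     k lo≤k _    _    k≤a' =
      ⊥-elim (1+n≰n (≤-trans (after j) (≤-trans lo≤k k≤a')))
    disjoint′ (fsuc j) (fsuc j') k l    h    l'   h'   = cong fsuc (disjoint j j' k l h l' h')

  Avoided : Fin t → ℕ → ℕ → ℕ → Set
  Avoided c B a b = ∃[ lo ] ∃[ hi ] a ≤ lo × hi ≤ b × B ≤ nb lo hi × ¬ Touches c lo hi

  cut-or-block : ∀ c {B} → 1 ≤ B → ∀ q a b → q * B ≤ nb a b → Avoided c B a b ⊎ TouchedBlocks c q a
  cut-or-block c B≥1 zero    a b _ = inj₂ no-blocks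
  cut-or-block c {B} B≥1 (suc q) a b enough
    with nb-prefix {a} {b} B≥1 (≤-trans (m≤m+n B _) enough)
  ... | a' , a'≤b , nb≡B with touches? c a a'
  ... | no  avoided = inj₁ (a , a' , ≤-refl , a'≤b , ≤-reflexive (≡-sym nb≡B) , avoided)
  ... | yes tc      = ⊎-map widen (cons-block first tc) (cut-or-block c B≥1 q (suc a') b remaining)
    where
    first : 1 ≤ nb a a'
    first = subst (1 ≤_) (≡-sym nb≡B) B≥1

    a≤1+a' : a ≤ suc a'
    a≤1+a' = m≤n⇒m≤1+n (nb-nonempty first)

    widen : Avoided c B (suc a') b → Avoided c B a b
    widen (lo , hi , a'<lo , rest) = lo , hi , ≤-trans a≤1+a' a'<lo , rest

    open ≤-Reasoning
    remaining : q * B ≤ nb (suc a') b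
    remaining = +-cancelˡ-≤ B _ _ (begin
      B + q * B                ≤⟨ enough ⟩
      nb a b                   ≡⟨ nb-split a≤1+a' a'≤b ⟩
      nb a a' + nb (suc a') b  ≡⟨ cong (_+ nb (suc a') b) nb≡B ⟩
      B + nb (suc a') b        ∎)

  module BlocksMinor {c : Fin t} {n a : ℕ} (blocks : TouchedBlocks c n a) where
    open TouchedBlocks blocks

    Block : Fin n → Fin N → Set
    Block j v = ∃[ i ] lo j ≤ toℕ i × toℕ i ≤ hi j × vert P i ≡ v

    Branch : Fin (2 + n) → Fin N → Set
    Branch fzero               v = v ≡ x
    Branch (fsuc fzero)        v = Component c v
    Branch (fsuc (fsuc j))     v = Block j v

    nonempty : ∀ b → ∃[ v ] Branch b v
    nonempty fzero           = x , refl
    nonempty (fsuc fzero)    = comp-onto c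
    nonempty (fsuc (fsuc j)) = let (i , lo≤i , i≤hi , _) = nb-witness (has-nbr j)
                               in vert P i , i , lo≤i , i≤hi , refl

    branches-disjoint : ∀ b b' v → Branch b v → Branch b' v → b ≡ b'
    branches-disjoint fzero fzero _ _ _ = refl
    branches-disjoint fzero (fsuc fzero) _ refl ((_ , v≢x) , _) = ⊥-elim (v≢x refl)
    branches-disjoint fzero (fsuc (fsuc _)) _ refl (i , _ , _ , i↦x) = ⊥-elim (x∉P (i , i↦x))
    branches-disjoint (fsuc fzero) fzero _ ((_ , v≢x) , _) refl = ⊥-elim (v≢x refl)
    branches-disjoint (fsuc fzero) (fsuc fzero) _ _ _ = refl
    branches-disjoint (fsuc fzero) (fsuc (fsuc _)) _ ((v∉P , _) , _) (i , _ , _ , i↦v) =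
      ⊥-elim (v∉P (i , i↦v))
    branches-disjoint (fsuc (fsuc _)) fzero _ (i , _ , _ , i↦x) refl = ⊥-elim (x∉P (i , i↦x))
    branches-disjoint (fsuc (fsuc _)) (fsuc fzero) _ (i , _ , _ , i↦v) ((v∉P , _) , _) =
      ⊥-elim (v∉P (i , i↦v))
    branches-disjoint (fsuc (fsuc j)) (fsuc (fsuc j')) _ (i , l , h , i↦v) (i' , l' , h' , i'↦v)
      with inj P i i' (trans i↦v (≡-sym i'↦v))
    ... | refl = cong (fsuc ∘ fsuc) (disjoint j j' (toℕ i) l h l' h')

    block-connected : ∀ j {u v} → Block j u → Block j v → Reach G (Block j) u v
    block-connected j (i , l , h , refl) (i' , l' , h' , refl) with toℕ i ≤? toℕ i'
    ... | yes i≤i' = segment-reach P (Block j) i≤i'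
                       (λ k i≤k k≤i' → k , ≤-trans l i≤k , ≤-trans k≤i' h' , refl)
    ... | no  i≰i' = reach-sym (segment-reach P (Block j) (<⇒≤ (≰⇒> i≰i'))
                       (λ k i'≤k k≤i → k , ≤-trans l' i'≤k , ≤-trans k≤i h , refl))

    branches-connected : ∀ b u v → Branch b u → Branch b v → Reach G (Branch b) u v
    branches-connected fzero           _ _ refl refl = here refl
    branches-connected (fsuc fzero)    _ _ cu cv = component-connected cu cv
    branches-connected (fsuc (fsuc j)) _ _ bu bv = block-connected j bu bv

    x-edge : ∀ j → ∃[ u ] ∃[ v ] (u ≡ x × Block j v × Edge G u v)
    x-edge j = let (i , l , h , e) = nb-witness (has-nbr j)
               in x , vert P i , refl , (i , l , h , refl) , e

    c-edge : ∀ j → ∃[ u ] ∃[ v ] (Component c u × Block j v × Edge G u v)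
    c-edge j = let (v , cv , i , l , h , e) = touched j in v , vert P i , cv , (i , l , h , refl) , e

    flip-edge : ∀ {A B : Fin N → Set} →
      ∃[ u ] ∃[ v ] (A u × B v × Edge G u v) → ∃[ v ] ∃[ u ] (B v × A u × Edge G v u)
    flip-edge (u , v , au , bv , e) = v , u , bv , au , edge-sym e

    branch-edges : ∀ b b' → Edge (K2 n) b b' → ∃[ u ] ∃[ v ] (Branch b u × Branch b' v × Edge G u v)
    branch-edges fzero           (fsuc (fsuc j)) _ = x-edge j
    branch-edges (fsuc fzero)    (fsuc (fsuc j)) _ = c-edge j
    branch-edges (fsuc (fsuc j)) fzero           _ = flip-edge (x-edge j)
    branch-edges (fsuc (fsuc j)) (fsuc fzero)    _ = flip-edge (c-edge j)

    minor : HasMinor G (K2 n)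
    minor = Branch , nonempty , branches-disjoint , branches-connected , branch-edges

  Confined : List (Fin t) → ℕ → ℕ → Set
  Confined L a b = ∀ v (s : Out v) i → a ≤ toℕ i → toℕ i ≤ b → Edge G v (vert P i) → comp v s ∈ L

  minor-or-subpath : ∀ {m n} → 1 ≤ m → 1 ≤ n → (L : List (Fin t)) → ∀ a b → b ≤ len P →
    Confined L a b → m * n ^ length L ≤ nb a b → HasMinor G (K2 n) ⊎ GoodSubpath G P x m
  minor-or-subpath {m} m≥1 n≥1 [] a b b≤len confined enough
    with nb-prefix {a} {b} m≥1 (subst (_≤ nb a b) (*-identityʳ m) enough)
  ... | c , c≤b , nb≡m =
    inj₂ (a , c , nb-nonempty {a} {c} (subst (1 ≤_) (≡-sym nb≡m) m≥1) , ≤-trans c≤b b≤len , nb≡m ,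
          λ v out i a≤i i≤c e → ∉[] (confined v out i a≤i (≤-trans i≤c c≤b) e))
    where
    ∉[] : ∀ {l : Fin t} → ¬ (l ∈ [])
    ∉[] ()
  minor-or-subpath {m} {n} m≥1 n≥1 (c ∷ L) a b b≤len confined enough
    with cut-or-block c (*-mono-≤ m≥1 (pow-positive (length L))) n a b n-blocks
    where
    pow-positive : ∀ k → 1 ≤ n ^ k
    pow-positive zero    = ≤-refl
    pow-positive (suc k) = *-mono-≤ n≥1 (pow-positive k)

    n-blocks : n * (m * n ^ length L) ≤ nb a b
    n-blocks = subst (_≤ nb a b) (x∙yz≈y∙xz m n (n ^ length L)) enough
  ... | inj₂ blocks = inj₁ (BlocksMinor.minor blocks)
  ... | inj₁ (lo , hi , a≤lo , hi≤b , enough′ , avoided) =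
    minor-or-subpath m≥1 n≥1 L lo hi (≤-trans hi≤b b≤len) confined′ enough′
    where
    -- c avoids P[lo..hi], so its neighbours there come from L
    confined′ : Confined L lo hi
    confined′ v out i lo≤i i≤hi e with confined v out i (≤-trans a≤lo lo≤i) (≤-trans i≤hi hi≤b) e
    ... | here  v∈c = ⊥-elim (avoided (v , (out , v∈c) , i , lo≤i , i≤hi , e))
    ... | there v∈L = v∈L

lemma4p1 : ∀ {N : ℕ} (G : Graph N) (m n t : ℕ) → 1 ≤ m → 1 ≤ n →
    (P : Path G) → Induced P → (x : Fin N) → ¬ (x ∈P P) →
    HasComponents G (Outside P x) t →
    (m + 2) * n ^ t ≤ nbrsInPath x P →
    HasMinor G (K2 n) ⊎ GoodSubpath G P x m
lemma4p1 G m n t m≥1 n≥1 P _ x x∉P (comp , comp-onto , comp-reach) enough =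
  minor-or-subpath m≥1 n≥1 (allFin t) 0 (len P) ≤-refl
    (λ v out _ _ _ _ → ∈-allFin (comp v out)) bound
  where
  open Components G P x x∉P comp comp-onto comp-reach
  open NeighbourCount x P using (nb; nb-whole)
  open ≤-Reasoning
  bound : m * n ^ length (allFin t) ≤ nb 0 (len P)
  bound = begin
    m * n ^ length (allFin t) ≡⟨ cong (λ k → m * n ^ k) (length-tabulate (id {A = Fin t})) ⟩
    m * n ^ t                 ≤⟨ *-monoˡ-≤ (n ^ t) (m≤m+n m 2) ⟩
    (m + 2) * n ^ t           ≤⟨ enough ⟩
    nbrsInPath x P            ≡⟨ ≡-sym nb-whole ⟩
    nb 0 (len P)              ∎
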